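{- Let $X$ be a totally disconnected compact Hausdorff space, and let $A$ be a Post algebra consisting of continuous $\mathfrak Z$-valued functions on $X$, with the pointwise operations of $\mathfrak Z_{\rm Post}$. For $f,g\in A$, write $f\preceq g$ iff for each $x\in X$ either $f(x)\le g(x)\le 1-g(x)$ or $f(x)\ge g(x)\ge 1-g(x)$. Then: (i) $\preceq$ is a partial order on $A$. (ii) An element $p\in A$ is $\preceq$-minimal iff it is Boolean, i.e. $p=\nabla p$. (iii) For every $n\ge1$, consider $\mathcal F_n=\mathfrak Z^{\{1,\dots,n\}}$, viewed as the set of nonempty faces of the $n$-cube. On $\mathcal F_n$, the partial order $\sqsubseteq$ given by inclusion of faces coincides with the relation $\preceq$ of the Post algebra $(\mathcal F_n,0,1/2,1,\neg,\nabla,\vee,\wedge)$ with pointwise operations.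
   Context: Let $\mathfrak Z=\{0,1/2,1\}$. $\mathfrak Z_{\rm Post}=(\mathfrak Z,0,1/2,1,\neg,\nabla,\vee,\wedge)$ has $\neg x=1-x$, $\nabla x=\min(1,2x)$, $x\vee y=\max(x,y)$, $x\wedge y=\min(x,y)$. Operations on function algebras are applied pointwise. A function $f\colon\{1,\dots,n\}\to\mathfrak Z$ is identified with the nonempty face $\{x\in[0,1]^n: x_i=f(i)\text{ whenever } f(i)\in\{0,1\}\}$ of the cube $[0,1]^n$. Under this identification, face inclusion $f\sqsubseteq g$ holds iff $f\sqcup g=g$ pointwise, where $x\sqcup y=x$ if $x=y$ and $x\sqcup y=1/2$ otherwise. -}

module Defs where

open import Level using (Level; suc; _⊔_)
open import Data.Nat using (ℕ; _≥_)
open import Data.Fin using (Fin)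
open import Data.List using (List)
open import Data.List.Relation.Unary.Any using (Any)
open import Data.Product using (Σ; _×_; ∃)
open import Data.Sum using (_⊎_)
open import Data.Empty using (⊥)
open import Data.Unit using (⊤)
open import Relation.Nullary using (¬_)
open import Relation.Binary.PropositionalEquality using (_≡_)

data Z : Set where
  z0 half z1 : Z

data _≤Z_ : Z → Z → Set where
  0≤ : ∀ {x} → z0 ≤Z x
  h≤h : half ≤Z half
  h≤1 : half ≤Z z1
  1≤1 : z1 ≤Z z1

negZ : Z → Z
negZ z0 = z1
negZ half = half
negZ z1 = z0

nablaZ : Z → Z
nablaZ z0 = z0
nablaZ half = z1
nablaZ z1 = z1

_∨Z_ : Z → Z → Z
z0 ∨Z y = y
half ∨Z z0 = half
half ∨Z half = half
half ∨Z z1 = z1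
z1 ∨Z y = z1

_∧Z_ : Z → Z → Z
z0 ∧Z y = z0
half ∧Z z0 = z0
half ∧Z half = half
half ∧Z z1 = half
z1 ∧Z y = y

_⊔Z_ : Z → Z → Z
z0 ⊔Z z0 = z0
z1 ⊔Z z1 = z1
_ ⊔Z half = half
half ⊔Z _ = half
z0 ⊔Z z1 = half
z1 ⊔Z z0 = half

_≈_ : ∀ {a} {X : Set a} → (X → Z) → (X → Z) → Set a
f ≈ g = ∀ x → f x ≡ g x

_⪯_ : ∀ {a} {X : Set a} → (X → Z) → (X → Z) → Set a
f ⪯ g = ∀ x → (f x ≤Z g x × g x ≤Z negZ (g x)) ⊎ (g x ≤Z f x × negZ (g x) ≤Z g x)

-- face inclusion on 𝔷^{1..n}: f ⊑ g iff f ⊔ g = g pointwise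
_⊑_ : ∀ {n} → (Fin n → Z) → (Fin n → Z) → Set
f ⊑ g = ∀ i → (f i ⊔Z g i) ≡ g i

record Topology (X : Set) : Set₁ where
  field
    Open       : (X → Set) → Set
    open-whole : Open (λ _ → ⊤)
    open-empty : Open (λ _ → ⊥)
    open-inter : ∀ {U V} → Open U → Open V → Open (λ x → U x × V x)
    open-union : (I : Set) (U : I → X → Set) → (∀ i → Open (U i)) →
                 Open (λ x → Σ I (λ i → U i x))

module _ {X : Set} (T : Topology X) where
  open Topology T

  Compact : Set₁
  Compact = (I : Set) (U : I → X → Set) → (∀ i → Open (U i)) →
            (∀ x → Σ I (λ i → U i x)) →
            Σ (List I) (λ is → ∀ x → Any (λ i → U i x) is)

  Hausdorff : Set₁
  Hausdorff = ∀ x y → ¬ (x ≡ y) →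
    Σ (X → Set) λ U → Σ (X → Set) λ V →
      Open U × Open V × U x × V y × (∀ z → U z → V z → ⊥)

  Disconnected : (X → Set) → Set₁
  Disconnected S = Σ (X → Set) λ U → Σ (X → Set) λ V →
      Open U × Open V × (∀ x → S x → U x ⊎ V x) ×
      (∀ x → S x → U x → V x → ⊥) ×
      Σ X (λ x → S x × U x) × Σ X (λ x → S x × V x)

  -- the only connected subsets are the empty set and singletons:
  -- every subset containing two distinct points is disconnected
  TotallyDisconnected : Set₁
  TotallyDisconnected = ∀ (S : X → Set) x y → S x → S y → ¬ (x ≡ y) →
    Disconnected S

  -- continuity of f : X → 𝔷 (𝔷 discrete): all fibres are open
  Continuous : (X → Z) → Set
  Continuous f = ∀ z → Open (λ x → f x ≡ z)

  record IsPostAlgebraOfContinuous (A : (X → Z) → Set) : Set where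
    field
      cont   : ∀ f → A f → Continuous f
      has-0  : A (λ _ → z0)
      has-h  : A (λ _ → half)
      has-1  : A (λ _ → z1)
      cl-neg : ∀ f → A f → A (λ x → negZ (f x))
      cl-nab : ∀ f → A f → A (λ x → nablaZ (f x))
      cl-or  : ∀ f g → A f → A g → A (λ x → f x ∨Z g x)
      cl-and : ∀ f g → A f → A g → A (λ x → f x ∧Z g x)

IsPartialOrderOn : {X : Set} (A : (X → Z) → Set) → ((X → Z) → (X → Z) → Set) → Set
IsPartialOrderOn A R =
  (∀ f → A f → R f f) ×
  (∀ f g → A f → A g → R f g → R g f → f ≈ g) ×
  (∀ f g h → A f → A g → A h → R f g → R g h → R f h)

Minimal : {X : Set} (A : (X → Z) → Set) → (X → Z) → Set
Minimal A p = ∀ q → A q → q ⪯ p → q ≈ p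

Boolean : {X : Set} → (X → Z) → Set
Boolean p = p ≈ (λ x → nablaZ (p x))

-- Pointwise, f ⪯ g and f ⊑ g are the same relation on 𝔷: every value g(x)
-- is either f(x) or 1/2 (the face of g keeps or frees each coordinate of f).
-- This is a partial order on 𝔷 with minimal elements 0 and 1, and since
-- ∇ p ⪯ p always holds, a ⪯-minimal element of an algebra closed under ∇
-- equals ∇ p. None of the topology, and nothing beyond closure under ∇, is needed.
module Submission where

open import Defs
open import Data.Nat using (ℕ; _≥_)
open import Data.Fin using (Fin)
open import Data.Product using (_×_; _,_)
open import Data.Sum using (_⊎_; inj₁; inj₂)
open import Function.Bundles using (_⇔_; mk⇔)
open import Relation.Binary.PropositionalEquality using (_≡_; refl; sym)

_⊑Z_ : Z → Z → Set
a ⊑Z b = a ≡ b ⊎ b ≡ half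

⊑Z-refl : ∀ {a} → a ⊑Z a
⊑Z-refl = inj₁ refl

⊑Z-antisym : ∀ {a b} → a ⊑Z b → b ⊑Z a → a ≡ b
⊑Z-antisym (inj₁ a≡b) _           = a≡b
⊑Z-antisym (inj₂ _)   (inj₁ b≡a)  = sym b≡a
⊑Z-antisym (inj₂ refl) (inj₂ refl) = refl

⊑Z-trans : ∀ {a b c} → a ⊑Z b → b ⊑Z c → a ⊑Z c
⊑Z-trans (inj₁ refl) b⊑c         = b⊑c
⊑Z-trans (inj₂ refl) (inj₁ refl) = inj₂ refl
⊑Z-trans _           (inj₂ c≡h)  = inj₂ c≡h

nablaZ-⊑Z : ∀ a → nablaZ a ⊑Z a
nablaZ-⊑Z z0   = inj₁ refl
nablaZ-⊑Z half = inj₂ refl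
nablaZ-⊑Z z1   = inj₁ refl

⊑Z-nablaZ-fixed : ∀ {a b} → b ≡ nablaZ b → a ⊑Z b → a ≡ b
⊑Z-nablaZ-fixed _  (inj₁ a≡b)  = a≡b
⊑Z-nablaZ-fixed () (inj₂ refl)

_≼_ : Z → Z → Set
a ≼ b = (a ≤Z b × b ≤Z negZ b) ⊎ (b ≤Z a × negZ b ≤Z b)

≼⇒⊑Z : ∀ {a b} → a ≼ b → a ⊑Z b
≼⇒⊑Z {b = half} _                  = inj₂ refl
≼⇒⊑Z {b = z0}   (inj₁ (0≤ , _))    = inj₁ refl
≼⇒⊑Z {b = z0}   (inj₂ (_ , ()))
≼⇒⊑Z {b = z1}   (inj₁ (_ , ()))
≼⇒⊑Z {b = z1}   (inj₂ (1≤1 , _))   = inj₁ refl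

⊑Z⇒≼ : ∀ {a b} → a ⊑Z b → a ≼ b
⊑Z⇒≼ {z0}   (inj₁ refl) = inj₁ (0≤ , 0≤)
⊑Z⇒≼ {half} (inj₁ refl) = inj₁ (h≤h , h≤h)
⊑Z⇒≼ {z1}   (inj₁ refl) = inj₂ (1≤1 , 0≤)
⊑Z⇒≼ {z0}   (inj₂ refl) = inj₁ (0≤ , h≤h)
⊑Z⇒≼ {half} (inj₂ refl) = inj₁ (h≤h , h≤h)
⊑Z⇒≼ {z1}   (inj₂ refl) = inj₂ (h≤1 , h≤h)

⊔Z-idem : ∀ a → a ⊔Z a ≡ a
⊔Z-idem z0   = refl
⊔Z-idem half = refl
⊔Z-idem z1   = refl

⊔Z-halfʳ : ∀ a → a ⊔Z half ≡ half
⊔Z-halfʳ z0   = refl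
⊔Z-halfʳ half = refl
⊔Z-halfʳ z1   = refl

⊔Z≡ʳ⇒⊑Z : ∀ a b → a ⊔Z b ≡ b → a ⊑Z b
⊔Z≡ʳ⇒⊑Z z0   z0   _  = inj₁ refl
⊔Z≡ʳ⇒⊑Z z1   z1   _  = inj₁ refl
⊔Z≡ʳ⇒⊑Z z0   half _  = inj₂ refl
⊔Z≡ʳ⇒⊑Z half half _  = inj₂ refl
⊔Z≡ʳ⇒⊑Z z1   half _  = inj₂ refl
⊔Z≡ʳ⇒⊑Z z0   z1   ()
⊔Z≡ʳ⇒⊑Z z1   z0   ()
⊔Z≡ʳ⇒⊑Z half z0   ()
⊔Z≡ʳ⇒⊑Z half z1   ()

⊑Z⇒⊔Z≡ʳ : ∀ a b → a ⊑Z b → a ⊔Z b ≡ b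
⊑Z⇒⊔Z≡ʳ a _ (inj₁ refl) = ⊔Z-idem a
⊑Z⇒⊔Z≡ʳ a _ (inj₂ refl) = ⊔Z-halfʳ a

module _ {X : Set} where

  ⪯-isPartialOrderOn : (A : (X → Z) → Set) → IsPartialOrderOn A _⪯_
  ⪯-isPartialOrderOn A =
      (λ f _ x → ⊑Z⇒≼ ⊑Z-refl)
    , (λ f g _ _ f⪯g g⪯f x → ⊑Z-antisym (≼⇒⊑Z (f⪯g x)) (≼⇒⊑Z (g⪯f x)))
    , (λ f g h _ _ _ f⪯g g⪯h x → ⊑Z⇒≼ (⊑Z-trans (≼⇒⊑Z (f⪯g x)) (≼⇒⊑Z (g⪯h x))))

  minimal⇔boolean : (A : (X → Z) → Set) → (∀ f → A f → A (λ x → nablaZ (f x))) →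
                    ∀ p → A p → Minimal A p ⇔ Boolean p
  minimal⇔boolean A closed p Ap = mk⇔ minimal⇒boolean boolean⇒minimal
    where
    minimal⇒boolean : Minimal A p → Boolean p
    minimal⇒boolean min x =
      sym (min (λ y → nablaZ (p y)) (closed p Ap) (λ y → ⊑Z⇒≼ (nablaZ-⊑Z (p y))) x)

    boolean⇒minimal : Boolean p → Minimal A p
    boolean⇒minimal bool q _ q⪯p x = ⊑Z-nablaZ-fixed (bool x) (≼⇒⊑Z (q⪯p x))

⊑⇔⪯ : ∀ {n} (f g : Fin n → Z) → f ⊑ g ⇔ f ⪯ g
⊑⇔⪯ f g = mk⇔
  (λ f⊑g i → ⊑Z⇒≼ (⊔Z≡ʳ⇒⊑Z (f i) (g i) (f⊑g i)))
  (λ f⪯g i → ⊑Z⇒⊔Z≡ʳ (f i) (g i) (≼⇒⊑Z (f⪯g i)))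

theorem4p4 :
  ((X : Set) (T : Topology X) → Compact T → Hausdorff T → TotallyDisconnected T →
    (A : (X → Z) → Set) → IsPostAlgebraOfContinuous T A →
      IsPartialOrderOn A _⪯_ ×
      (∀ p → A p → (Minimal A p ⇔ Boolean p)))
  ×
  (∀ (n : ℕ) → n ≥ 1 → (f g : Fin n → Z) → (f ⊑ g ⇔ f ⪯ g))
theorem4p4 =
    (λ X T _ _ _ A isPost →
        ⪯-isPartialOrderOn A
      , minimal⇔boolean A (IsPostAlgebraOfContinuous.cl-nab isPost))
  , λ n _ → ⊑⇔⪯
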